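{- There is an absolute constant $C>0$ such that for every integer $n\ge 4$ and every $n$-staggler $P$, there exists a polyomino context-free grammar of size at most $C\log n$ deriving $P$.
   Context: Write $\log n$ for $\lfloor \log_2 n\rfloor$ and let $m=\lfloor n/\log n\rfloor$. An $n$-staggler is a polyomino (all cells carrying the same label) consisting of $\log n$ horizontal bars, each a $m\times 1$ row of cells; bar $k$ ($k=1,\dots,\log n$) occupies row $y=k-1$, and each bar is horizontally offset relative to the bar directly below it by an integer in $\{ -(m-1),\dots,m-1\}$ (so every sequence of $\log n-1$ such offsets determines an $n$-staggler). A labeled polyomino is a finite connected set of cells of $\mathbb{Z}^2$ with a label (from some alphabet) on each cell, considered up to translation. A polyomino context-free grammar (PCFG) is $G=(\Sigma,\Gamma,S,\Delta)$ with terminal symbols $\Sigma$ (labels), non-terminal symbols $\Gamma$, start symbol $S\in\Gamma$, and a set $\Delta$ of production rules, each non-terminal $N$ being the left-hand side of exactly one rule $N\to (R_1,(x_1,y_1))\cdots(R_j,(x_j,y_j))$ with $R_i\in\Sigma\cup\Gamma$ and $(x_i,y_i)\in\mathbb{Z}^2$. Derivation starts from $S$ placed at the origin; a non-terminal $N$ placed at position $p$ is replaced by the symbols $R_i$ placed at $p+(x_i,y_i)$; a terminal $a$ placed at $p$ becomes a cell at $p$ labeled $a$. The grammar derives the polyomino formed by the resulting terminal cells, which are required to be pairwise disjoint and to form a connected set. The size of $G$ is the total number of symbols on the right-hand sides of all rules. -}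

module Defs where

open import Data.Nat as ℕ using (ℕ; zero; suc; _/_)
open import Data.Nat.Logarithm using (⌊log₂_⌋)
open import Data.Integer as ℤ using (ℤ; +_)
open import Data.Fin using (Fin)
open import Data.List using (List; []; _∷_; _++_; map; length; allFin)
open import Data.Nat.ListAction using (sum)
open import Data.List.Membership.Propositional using (_∈_)
open import Data.List.Relation.Unary.All using (All)
open import Data.List.Relation.Unary.Unique.Propositional using (Unique)
open import Data.Product using (Σ; _×_; _,_; proj₁; ∃)
open import Data.Sum using (_⊎_; inj₁; inj₂)
open import Function.Bundles using (_⇔_)
open import Relation.Binary.PropositionalEquality using (_≡_)

lg : ℕ → ℕ
lg n = ⌊log₂ n ⌋

-- m := ⌊ n / log n ⌋   (the case log n = 0 never occurs for n ≥ 4)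
mLen : ℕ → ℕ
mLen n with lg n
... | zero  = zero
... | suc k = n / suc k

Pos : Set
Pos = ℤ × ℤ

_⊕_ : Pos → Pos → Pos
(a , b) ⊕ (c , d) = (a ℤ.+ c , b ℤ.+ d)

_⊖_ : Pos → Pos → Pos
(a , b) ⊖ (c , d) = (a ℤ.- c , b ℤ.- d)

Adjacent : Pos → Pos → Set
Adjacent (x , y) (x' , y') =
  (y ≡ y' × (x' ≡ x ℤ.+ ℤ.1ℤ ⊎ x ≡ x' ℤ.+ ℤ.1ℤ)) ⊎
  (x ≡ x' × (y' ≡ y ℤ.+ ℤ.1ℤ ⊎ y ≡ y' ℤ.+ ℤ.1ℤ))

data PathIn (S : List Pos) : Pos → Pos → Set where
  here : ∀ {p} → p ∈ S → PathIn S p p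
  step : ∀ {p q r} → p ∈ S → Adjacent p q → PathIn S q r → PathIn S p r

Connected : List Pos → Set
Connected S = ∀ {p q} → p ∈ S → q ∈ S → PathIn S p q

-- left end of bar number k (0-based), given offsets d₁ … d_{log n − 1}
-- bar (k+1) starts at (start of bar k) + d_{k+1}
barStart : List ℤ → ℕ → ℤ
barStart ds       zero    = + 0
barStart []       (suc k) = + 0
barStart (d ∷ ds) (suc k) = d ℤ.+ barStart ds k

ValidOffsets : ℕ → List ℤ → Set
ValidOffsets n ds =
  length ds ≡ lg n ℕ.∸ 1 × All (λ d → ℤ.∣ d ∣ ℕ.≤ mLen n ℕ.∸ 1) ds

InStaggler : ℕ → List ℤ → Pos → Set
InStaggler n ds (x , y) =
  Σ ℕ λ k → k ℕ.< lg n × y ≡ + k ×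
    (barStart ds k ℤ.≤ x × x ℤ.< barStart ds k ℤ.+ + mLen n)

record PCFG (A : Set) : Set where
  field
    nNT   : ℕ
    start : Fin nNT
    rules : Fin nNT → List ((A ⊎ Fin nNT) × Pos)

  Sym : Set
  Sym = A ⊎ Fin nNT

  size : ℕ
  size = sum (map (λ N → length (rules N)) (allFin nNT))

  mutual
    data Yields : Sym → Pos → List (Pos × A) → Set where
      term    : ∀ {a p} → Yields (inj₁ a) p ((p , a) ∷ [])
      nonterm : ∀ {N p L} → YieldsAll (rules N) p L → Yields (inj₂ N) p L

    data YieldsAll : List (Sym × Pos) → Pos → List (Pos × A) → Set where
      []  : ∀ {p} → YieldsAll [] p []
      _∷_ : ∀ {R o rs p L₁ L₂} →
            Yields R (p ⊕ o) L₁ → YieldsAll rs p L₂ →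
            YieldsAll ((R , o) ∷ rs) p (L₁ ++ L₂)

  DerivesCells : List (Pos × A) → Set
  DerivesCells L =
    Yields (inj₂ start) (+ 0 , + 0) L ×
    Unique (map proj₁ L) ×
    Connected (map proj₁ L)

DerivesStaggler : {A : Set} → PCFG A → A → ℕ → List ℤ → Set
DerivesStaggler {A} G a n ds =
  Σ (List (Pos × A)) λ L → PCFG.DerivesCells G L ×
    Σ Pos λ t → ∀ (q : Pos) (b : A) →
      ((q , b) ∈ L) ⇔ (b ≡ a × InStaggler n ds (q ⊖ t))

-- Write m in binary with ⌊log₂ n⌋ + 1 bits. For every suffix c of the bit
-- string there is a non-terminal deriving a bar whose length is the value of c:
-- the bar of b ∷ c is two adjacent copies of the bar of c followed by one extra
-- cell when b = 1, so each such rule has at most three symbols. The start rule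
-- places one copy of the full bar at the left end of each of the log n rows,
-- giving size at most log n + 3(log n + 1) ≤ 7 log n. Distinct rows are
-- disjoint, and since consecutive offsets are smaller than m in absolute value,
-- consecutive bars share a column, which makes the staggler connected.
module Submission where

open import Defs
open import Data.Nat using (ℕ; _≤_; _*_; _>_; _≥_)
open import Data.Integer using (ℤ)
open import Data.List using (List)
open import Data.Product using (Σ; _×_)

open import Algebra.Bundles using (AbelianGroup)
open import Data.Bool using (Bool; true; false)
open import Data.Empty using (⊥)
open import Data.Fin using (Fin; zero; suc)
open import Data.Integer as ℤ using (+_; -[1+_]; +≤+; +<+)
import Data.Integer.Properties as ℤP
import Data.Integer.Tactic.RingSolver as ℤRing
open import Data.List using ([]; _∷_; _++_; length; map; tabulate; applyUpTo; upTo)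
open import Data.List.Membership.Propositional using (_∈_)
open import Data.List.Membership.Propositional.Properties
  using (∈-++⁻; ∈-++⁺ˡ; ∈-++⁺ʳ; ∈-map⁺; ∈-map⁻; ∈-applyUpTo⁺; ∈-applyUpTo⁻)
open import Data.List.Properties using (map-tabulate; map-++; map-∘; map-id; map-cong; map-upTo; ++-assoc)
open import Data.List.Relation.Unary.All using (All; _∷_)
open import Data.List.Relation.Unary.Unique.Propositional using (Unique)
open import Data.List.Relation.Unary.Unique.Propositional.Properties using (++⁺; applyUpTo⁺₁)
open import Data.Nat using (zero; suc; _+_; _<_; _∸_; _^_; z≤n; s≤s)
open import Data.Nat.DivMod using (m/n≤m)
open import Data.Nat.Logarithm using (⌊log₂_⌋; ⌊log₂⌋-mono-≤; ⌊log₂[2^n]⌋≡n)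
import Data.Nat.Properties as ℕP
import Data.Nat.Tactic.RingSolver as ℕRing
open import Data.Nat.ListAction using (sum)
open import Data.Product using (_,_; proj₁; proj₂)
open import Data.Product.Function.NonDependent.Propositional using (_×-⇔_)
open import Data.Sum using (_⊎_; inj₁; inj₂)
open import Function.Base using (_∘_)
open import Function.Bundles using (_⇔_; mk⇔)
open import Function.Construct.Composition using (_⇔-∘_)
open import Function.Construct.Identity using (⇔-id)
open import Relation.Binary.PropositionalEquality

open import Algebra.Properties.Group (AbelianGroup.group ℤP.+-0-abelianGroup) using (∙-cancelˡ)
open import Algebra.Properties.CommutativeSemigroup ℤP.+-commutativeSemigroup using (x∙yz≈y∙xz)

bit : Bool → ℕ
bit false = 0
bit true  = 1

-- Least significant bit first.
fromBits : List Bool → ℕ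
fromBits []       = 0
fromBits (b ∷ bs) = fromBits bs + fromBits bs + bit b

halve : ∀ x → Σ Bool λ b → Σ ℕ λ y → x ≡ y + y + bit b
halve zero = false , 0 , refl
halve (suc x) with halve x
... | false , y , x≡ = true , y , trans (cong suc x≡) (sym (ℕP.+-suc (y + y) 0))
... | true  , y , x≡ = false , suc y , trans (cong suc x≡) (carry y)
  where
  carry : ∀ y → suc (y + y + 1) ≡ suc y + suc y + 0
  carry = ℕRing.solve-∀

half-< : ∀ {y z} → y + y < z + z → y < z
half-< y+y<z+z = ℕP.≰⇒> λ z≤y → ℕP.<⇒≱ y+y<z+z (ℕP.+-mono-≤ z≤y z≤y)

toBits : ∀ f x → x < 2 ^ f → Σ (List Bool) λ bs → length bs ≡ f × fromBits bs ≡ x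
toBits zero    zero    _        = [] , refl , refl
toBits zero    (suc x) (s≤s ())
toBits (suc f) x x<2^[1+f] with halve x
... | b , y , refl with toBits f y (half-< y+y<2^f+2^f)
  where
  y+y<2^f+2^f : y + y < 2 ^ f + 2 ^ f
  y+y<2^f+2^f = subst (λ t → y + y < 2 ^ f + t) (ℕP.+-identityʳ (2 ^ f))
                  (ℕP.≤-<-trans (ℕP.m≤m+n (y + y) (bit b)) x<2^[1+f])
... | bs , refl , refl = b ∷ bs , refl , refl

n<2^[1+⌊log₂n⌋] : ∀ n → n < 2 ^ suc ⌊log₂ n ⌋
n<2^[1+⌊log₂n⌋] n = ℕP.≰⇒> λ 2^[1+⌊log₂n⌋]≤n →
  ℕP.1+n≰n (subst (_≤ ⌊log₂ n ⌋) (⌊log₂[2^n]⌋≡n (suc ⌊log₂ n ⌋)) (⌊log₂⌋-mono-≤ 2^[1+⌊log₂n⌋]≤n))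

mLen≤n : ∀ n → mLen n ≤ n
mLen≤n n with lg n
... | zero  = z≤n
... | suc k = m/n≤m n (suc k)

≤∸1⇒< : ∀ {e m} → 0 < m → e ≤ m ∸ 1 → e < m
≤∸1⇒< {m = suc m} _ e≤m = s≤s e≤m

<⇒≤∸1 : ∀ {r k} → r < k → r ≤ k ∸ 1
<⇒≤∸1 (s≤s r≤k) = r≤k

+-cancelˡ-≡ : ∀ i {j k} → i ℤ.+ j ≡ i ℤ.+ k → j ≡ k
+-cancelˡ-≡ i = ∙-cancelˡ i _ _

⊕-identityˡ : ∀ p → (+ 0 , + 0) ⊕ p ≡ p
⊕-identityˡ (x , y) = cong₂ _,_ (ℤP.+-identityˡ x) (ℤP.+-identityˡ y)

⊕-identityʳ : ∀ p → p ⊕ (+ 0 , + 0) ≡ p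
⊕-identityʳ (x , y) = cong₂ _,_ (ℤP.+-identityʳ x) (ℤP.+-identityʳ y)

-- x ℤ.- + 0 unfolds to x ℤ.+ + 0.
⊖-identityʳ : ∀ p → p ⊖ (+ 0 , + 0) ≡ p
⊖-identityʳ = ⊕-identityʳ

applyUpTo-+ : ∀ {A : Set} (f : ℕ → A) m n → applyUpTo f (m + n) ≡ applyUpTo f m ++ applyUpTo (λ i → f (m + i)) n
applyUpTo-+ f zero    n = refl
applyUpTo-+ f (suc m) n = cong (f 0 ∷_) (applyUpTo-+ (f ∘ suc) m n)

applyUpTo-cong : ∀ {A : Set} {f g : ℕ → A} → (∀ i → f i ≡ g i) → ∀ n → applyUpTo f n ≡ applyUpTo g n
applyUpTo-cong {f = f} {g} f≗g n = trans (sym (map-upTo f n)) (trans (map-cong f≗g (upTo n)) (map-upTo g n))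

segment : ℕ → Pos → List Pos
segment w (x , y) = applyUpTo (λ i → (x ℤ.+ + i , y)) w

segment-+ : ∀ u w p → segment (u + w) p ≡ segment u p ++ segment w (p ⊕ (+ u , + 0))
segment-+ u w (x , y) = trans (applyUpTo-+ _ u w) (cong (segment u (x , y) ++_) (applyUpTo-cong shift w))
  where
  shift : ∀ i → (x ℤ.+ + (u + i) , y) ≡ ((x ℤ.+ + u) ℤ.+ + i , y ℤ.+ + 0)
  shift i = cong₂ _,_ (sym (ℤP.+-assoc x (+ u) (+ i))) (sym (ℤP.+-identityʳ y))

segment-double : ∀ v c p →
  segment v (p ⊕ (+ 0 , + 0)) ++ (segment v (p ⊕ (+ v , + 0)) ++ segment c (p ⊕ (+ (v + v) , + 0)))
    ≡ segment (v + v + c) p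
segment-double v c p = begin
  segment v (p ⊕ (+ 0 , + 0)) ++ (V₂ ++ C)  ≡⟨ cong (λ q → segment v q ++ (V₂ ++ C)) (⊕-identityʳ p) ⟩
  segment v p ++ (V₂ ++ C)                  ≡⟨ ++-assoc (segment v p) V₂ C ⟨
  (segment v p ++ V₂) ++ C                  ≡⟨ cong (_++ C) (segment-+ v v p) ⟨
  segment (v + v) p ++ C                    ≡⟨ segment-+ (v + v) c p ⟨
  segment (v + v + c) p                     ∎
  where
  open ≡-Reasoning
  V₂ = segment v (p ⊕ (+ v , + 0))
  C  = segment c (p ⊕ (+ (v + v) , + 0))

segment-unique : ∀ w p → Unique (segment w p)
segment-unique w (x , y) = applyUpTo⁺₁ _ w λ i<j _ eq →
  ℕP.<⇒≢ i<j (ℤP.+-injective (+-cancelˡ-≡ x (cong proj₁ eq)))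

bars : (ℕ → ℤ) → ℕ → ℕ → List Pos
bars s m zero    = []
bars s m (suc r) = segment m (s r , + r) ++ bars s m r

barCell : (ℕ → ℤ) → ℕ → ℕ → Pos
barCell s r i = (s r ℤ.+ + i , + r)

module _ {s : ℕ → ℤ} {m : ℕ} where

  ∈-bars⁻ : ∀ {k q} → q ∈ bars s m k → Σ ℕ λ r → r < k × Σ ℕ λ i → i < m × q ≡ barCell s r i
  ∈-bars⁻ {suc k} q∈ with ∈-++⁻ (segment m (s k , + k)) q∈
  ... | inj₁ q∈bar with ∈-applyUpTo⁻ _ q∈bar
  ...   | i , i<m , q≡ = k , ℕP.n<1+n k , i , i<m , q≡
  ∈-bars⁻ {suc k} q∈ | inj₂ q∈bars with ∈-bars⁻ q∈bars
  ...   | r , r<k , i , i<m , q≡ = r , ℕP.m<n⇒m<1+n r<k , i , i<m , q≡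

  ∈-bars⁺ : ∀ {k r i} → r < k → i < m → barCell s r i ∈ bars s m k
  ∈-bars⁺ {suc k} {r} r<1+k i<m with ℕP.m<1+n⇒m<n∨m≡n r<1+k
  ... | inj₁ r<k  = ∈-++⁺ʳ (segment m (s k , + k)) (∈-bars⁺ r<k i<m)
  ... | inj₂ refl = ∈-++⁺ˡ (∈-applyUpTo⁺ _ i<m)

  -- The right-hand side is InStaggler n ds (x , y) for s, m, k = barStart ds, mLen n, lg n.
  ∈-bars : ∀ {k x y} → (x , y) ∈ bars s m k ⇔ (Σ ℕ λ r → r < k × y ≡ + r × (s r ℤ.≤ x × x ℤ.< s r ℤ.+ + m))
  ∈-bars {k} {x} {y} = mk⇔ to from
    where
    to : (x , y) ∈ bars s m k → Σ ℕ λ r → r < k × y ≡ + r × (s r ℤ.≤ x × x ℤ.< s r ℤ.+ + m)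
    to q∈ with ∈-bars⁻ {k} q∈
    ... | r , r<k , i , i<m , refl = r , r<k , refl , ℤP.i≤i+j (s r) (+ i) , ℤP.+-monoʳ-< (s r) (+<+ i<m)

    from : (Σ ℕ λ r → r < k × y ≡ + r × (s r ℤ.≤ x × x ℤ.< s r ℤ.+ + m)) → (x , y) ∈ bars s m k
    from (r , r<k , refl , sr≤x , x<sr+m) = subst (_∈ bars s m k) (cong (_, + r) x≡) (∈-bars⁺ r<k i<m)
      where
      i = ℤ.∣ x ℤ.- s r ∣
      x≡ : s r ℤ.+ + i ≡ x
      x≡ = trans (cong (λ t → s r ℤ.+ t) (ℤP.0≤i⇒+∣i∣≡i (ℤP.i≤j⇒0≤j-i sr≤x))) (split x (s r))
        where
        split : ∀ x t → t ℤ.+ (x ℤ.- t) ≡ x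
        split = ℤRing.solve-∀
      i<m : i < m
      i<m = ℕP.≰⇒> λ m≤i → ℤP.<⇒≱ x<sr+m (subst (s r ℤ.+ + m ℤ.≤_) x≡ (ℤP.+-monoʳ-≤ (s r) (+≤+ m≤i)))

  bars-unique : ∀ k → Unique (bars s m k)
  bars-unique zero    = Unique.[]
  bars-unique (suc k) = ++⁺ (segment-unique m (s k , + k)) (bars-unique k) disjoint
    where
    disjoint : ∀ {q} → q ∈ segment m (s k , + k) × q ∈ bars s m k → ⊥
    disjoint (q∈bar , q∈bars) with ∈-applyUpTo⁻ _ q∈bar | ∈-bars⁻ {k} q∈bars
    ... | _ , _ , refl | r , r<k , _ , _ , q≡ = ℕP.<⇒≢ r<k (sym (ℤP.+-injective (cong proj₂ q≡)))

Adjacent-sym : ∀ {p q} → Adjacent p q → Adjacent q p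
Adjacent-sym (inj₁ (y≡ , inj₁ x≡)) = inj₁ (sym y≡ , inj₂ x≡)
Adjacent-sym (inj₁ (y≡ , inj₂ x≡)) = inj₁ (sym y≡ , inj₁ x≡)
Adjacent-sym (inj₂ (x≡ , inj₁ y≡)) = inj₂ (sym x≡ , inj₂ y≡)
Adjacent-sym (inj₂ (x≡ , inj₂ y≡)) = inj₂ (sym x≡ , inj₁ y≡)

module _ {S : List Pos} where

  PathIn-source : ∀ {p q} → PathIn S p q → p ∈ S
  PathIn-source (here p∈) = p∈
  PathIn-source (step p∈ _ _) = p∈

  PathIn-trans : ∀ {p q r} → PathIn S p q → PathIn S q r → PathIn S p r
  PathIn-trans (here _) γ = γ
  PathIn-trans (step p∈ p~ β) γ = step p∈ p~ (PathIn-trans β γ)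

  PathIn-sym : ∀ {p q} → PathIn S p q → PathIn S q p
  PathIn-sym (here p∈) = here p∈
  PathIn-sym (step p∈ p~ β) = PathIn-trans (PathIn-sym β) (step (PathIn-source β) (Adjacent-sym p~) (here p∈))

module _ {s : ℕ → ℤ} {m k : ℕ} where

  private
    S = bars s m k

  toBarStart : ∀ {r i} → r < k → i < m → PathIn S (barCell s r i) (barCell s r 0)
  toBarStart {i = zero}      r<k 0<m = here (∈-bars⁺ r<k 0<m)
  toBarStart {r} {i = suc i} r<k i<m =
    step (∈-bars⁺ r<k i<m) (inj₁ (refl , inj₂ x≡)) (toBarStart r<k (ℕP.<-trans (ℕP.n<1+n i) i<m))
    where
    x≡ : s r ℤ.+ + suc i ≡ (s r ℤ.+ + i) ℤ.+ + 1
    x≡ = trans (cong (λ t → s r ℤ.+ + t) (ℕP.+-comm 1 i)) (sym (ℤP.+-assoc (s r) (+ i) (+ 1)))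

  alongBar : ∀ {r i j} → r < k → i < m → j < m → PathIn S (barCell s r i) (barCell s r j)
  alongBar r<k i<m j<m = PathIn-trans (toBarStart r<k i<m) (PathIn-sym (toBarStart r<k j<m))

  -- A column shared by bars r + 1 and r: the left end of the upper bar when it
  -- is shifted right, the left end of the lower bar otherwise.
  sharedColumn : ∀ {r} d → 0 < m → ℤ.∣ d ∣ ≤ m ∸ 1 → s (suc r) ≡ d ℤ.+ s r →
    Σ ℕ λ i → Σ ℕ λ j → i < m × j < m × s (suc r) ℤ.+ + i ≡ s r ℤ.+ + j
  sharedColumn {r} (+ e) 0<m e≤m∸1 s≡ =
    0 , e , 0<m , ≤∸1⇒< 0<m e≤m∸1 ,
    trans (ℤP.+-identityʳ (s (suc r))) (trans s≡ (ℤP.+-comm (+ e) (s r)))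
  sharedColumn {r} -[1+ e ] 0<m 1+e≤m∸1 s≡ =
    suc e , 0 , ≤∸1⇒< 0<m 1+e≤m∸1 , 0<m , trans (cong (ℤ._+ + suc e) s≡) (cancel (+ suc e) (s r))
    where
    cancel : ∀ u t → (ℤ.- u ℤ.+ t) ℤ.+ u ≡ t ℤ.+ + 0
    cancel = ℤRing.solve-∀

  module _ (staggered : ∀ r → suc r < k → Σ ℤ λ d → ℤ.∣ d ∣ ≤ m ∸ 1 × s (suc r) ≡ d ℤ.+ s r) where

    toOrigin : ∀ {r i} → r < k → i < m → PathIn S (barCell s r i) (barCell s 0 0)
    toOrigin {zero}  0<k i<m = alongBar 0<k i<m (ℕP.≤-<-trans z≤n i<m)
    toOrigin {suc r} r+1<k i<m with staggered r r+1<k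
    ... | d , d≤ , s≡ with sharedColumn d (ℕP.≤-<-trans z≤n i<m) d≤ s≡
    ...   | j , j′ , j<m , j′<m , x≡ =
      PathIn-trans (alongBar r+1<k i<m j<m)
        (step (∈-bars⁺ r+1<k j<m) (inj₂ (x≡ , inj₂ (cong +_ (ℕP.+-comm 1 r))))
          (toOrigin (ℕP.<-trans (ℕP.n<1+n r) r+1<k) j′<m))

    bars-connected : Connected S
    bars-connected p∈ q∈ with ∈-bars⁻ {k = k} p∈ | ∈-bars⁻ {k = k} q∈
    ... | _ , r<k , _ , i<m , refl | _ , r′<k , _ , i′<m , refl =
      PathIn-trans (toOrigin r<k i<m) (PathIn-sym (toOrigin r′<k i′<m))

withLabel : {A : Set} → A → List Pos → List (Pos × A)
withLabel a = map (_, a)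

∈-withLabel : ∀ {A : Set} {a b : A} {q S} → (q , b) ∈ withLabel a S ⇔ (b ≡ a × q ∈ S)
∈-withLabel {a = a} {b} {q} {S} = mk⇔ to λ { (refl , q∈S) → ∈-map⁺ (_, a) q∈S }
  where
  to : (q , b) ∈ withLabel a S → b ≡ a × q ∈ S
  to q,b∈ with ∈-map⁻ (_, a) q,b∈
  ... | _ , q∈S , refl = refl , q∈S

proj₁-withLabel : ∀ {A : Set} (a : A) S → map proj₁ (withLabel a S) ≡ S
proj₁-withLabel a S = trans (sym (map-∘ {g = proj₁} {f = _, a} S)) (map-id S)

-- Non-terminal 0 is the start symbol and non-terminal j + 1 derives the bar
-- for the j-th suffix of bs; the last one, for the empty suffix, has an empty rule.
module StagglerGrammar {A : Set} (a : A) (bs : List Bool) (rows : ℕ) (s : ℕ → ℤ) where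

  NT : Set
  NT = Fin (2 + length bs)

  Rule : Set
  Rule = List ((A ⊎ NT) × Pos)

  extraRule : Bool → ℕ → Rule
  extraRule false _ = []
  extraRule true  v = (inj₁ a , (+ (v + v) , + 0)) ∷ []

  doublingRules : (cs : List Bool) → (Fin (suc (length cs)) → NT) → Fin (suc (length cs)) → Rule
  doublingRules []       _    _       = []
  doublingRules (b ∷ cs) name zero    =
    (inj₂ (name (suc zero)) , (+ 0 , + 0)) ∷ (inj₂ (name (suc zero)) , (+ fromBits cs , + 0)) ∷ extraRule b (fromBits cs)
  doublingRules (b ∷ cs) name (suc j) = doublingRules cs (name ∘ suc) j

  stackRule : ℕ → Rule
  stackRule zero    = []
  stackRule (suc r) = (inj₂ (suc zero) , (s r , + r)) ∷ stackRule r

  rules : NT → Rule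
  rules zero    = stackRule rows
  rules (suc j) = doublingRules bs suc j

  grammar : PCFG A
  grammar = record { nNT = 2 + length bs ; start = zero ; rules = rules }

  open PCFG grammar using (Yields; YieldsAll; term; nonterm; []; _∷_; size)

  extra-yields : ∀ b v p → YieldsAll (extraRule b v) p (withLabel a (segment (bit b) (p ⊕ (+ (v + v) , + 0))))
  extra-yields false v p       = []
  extra-yields true  v (x , y) =
    subst (YieldsAll _ (x , y)) (cong (λ t → (t , a) ∷ []) (cong (_, y ℤ.+ + 0) (sym (ℤP.+-identityʳ _)))) (term ∷ [])

  bar-yields : ∀ cs (name : Fin (suc (length cs)) → NT) → (∀ j → rules (name j) ≡ doublingRules cs name j) →
    ∀ p → Yields (inj₂ (name zero)) p (withLabel a (segment (fromBits cs) p))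
  bar-yields []       name rules≡ p = nonterm (subst (λ R → YieldsAll R p []) (sym (rules≡ zero)) [])
  bar-yields (b ∷ cs) name rules≡ p =
    nonterm (subst₂ (λ R → YieldsAll R p) (sym (rules≡ zero)) labelled
      (half (p ⊕ (+ 0 , + 0)) ∷ half (p ⊕ (+ v , + 0)) ∷ extra-yields b v p))
    where
    v = fromBits cs
    half = bar-yields cs (name ∘ suc) (rules≡ ∘ suc)
    V₁ = segment v (p ⊕ (+ 0 , + 0))
    V₂ = segment v (p ⊕ (+ v , + 0))
    C  = segment (bit b) (p ⊕ (+ (v + v) , + 0))
    labelled : withLabel a V₁ ++ (withLabel a V₂ ++ withLabel a C) ≡ withLabel a (segment (v + v + bit b) p)
    labelled = begin
      withLabel a V₁ ++ (withLabel a V₂ ++ withLabel a C)  ≡⟨ cong (withLabel a V₁ ++_) (map-++ (_, a) V₂ C) ⟨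
      withLabel a V₁ ++ withLabel a (V₂ ++ C)              ≡⟨ map-++ (_, a) V₁ (V₂ ++ C) ⟨
      withLabel a (V₁ ++ (V₂ ++ C))                        ≡⟨ cong (withLabel a) (segment-double v (bit b) p) ⟩
      withLabel a (segment (v + v + bit b) p)              ∎
      where open ≡-Reasoning

  stack-yields : ∀ r → YieldsAll (stackRule r) (+ 0 , + 0) (withLabel a (bars s (fromBits bs) r))
  stack-yields zero    = []
  stack-yields (suc r) = subst (YieldsAll _ _) (sym (map-++ (_, a) _ (bars s (fromBits bs) r))) (bar ∷ stack-yields r)
    where
    bar : Yields (inj₂ (suc zero)) ((+ 0 , + 0) ⊕ (s r , + r)) (withLabel a (segment (fromBits bs) (s r , + r)))
    bar = subst (λ q → Yields (inj₂ (suc zero)) ((+ 0 , + 0) ⊕ (s r , + r)) (withLabel a (segment (fromBits bs) q)))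
            (⊕-identityˡ (s r , + r)) (bar-yields bs suc (λ _ → refl) ((+ 0 , + 0) ⊕ (s r , + r)))

  start-yields : Yields (inj₂ zero) (+ 0 , + 0) (withLabel a (bars s (fromBits bs) rows))
  start-yields = nonterm (stack-yields rows)

  length-stackRule : ∀ r → length (stackRule r) ≡ r
  length-stackRule zero    = refl
  length-stackRule (suc r) = cong suc (length-stackRule r)

  length-extraRule≤1 : ∀ b v → length (extraRule b v) ≤ 1
  length-extraRule≤1 false _ = z≤n
  length-extraRule≤1 true  _ = s≤s z≤n

  size-doublingRules : ∀ cs name → sum (tabulate (λ j → length (doublingRules cs name j))) ≤ 3 * length cs
  size-doublingRules []       name = z≤n
  size-doublingRules (b ∷ cs) name =
    ℕP.≤-trans (ℕP.+-mono-≤ (s≤s (s≤s (length-extraRule≤1 b (fromBits cs)))) (size-doublingRules cs (name ∘ suc)))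
               (ℕP.≤-reflexive (sym (ℕP.*-suc 3 (length cs))))

  grammar-size : size ≤ rows + 3 * length bs
  grammar-size = subst (_≤ rows + 3 * length bs) (cong sum (sym (map-tabulate (λ N → N) (length ∘ rules))))
    (ℕP.+-mono-≤ (ℕP.≤-reflexive (length-stackRule rows)) (size-doublingRules bs suc))

barStart-step : ∀ {P : ℤ → Set} {ds} k → suc k ≤ length ds → All P ds →
  Σ ℤ λ d → P d × barStart ds (suc k) ≡ d ℤ.+ barStart ds k
barStart-step {ds = d ∷ ds} zero    _           (Pd ∷ _)   = d , Pd , refl
barStart-step {ds = d ∷ ds} (suc k) (s≤s k<|ds|) (_ ∷ Pds) with barStart-step k k<|ds| Pds
... | d′ , Pd′ , s≡ = d′ , Pd′ , trans (cong (λ t → d ℤ.+ t) s≡) (x∙yz≈y∙xz d d′ (barStart ds k))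

stagglerGrammar-derives : ∀ {A : Set} (a : A) n ds bs → fromBits bs ≡ mLen n → ValidOffsets n ds →
  DerivesStaggler (StagglerGrammar.grammar a bs (lg n) (barStart ds)) a n ds
stagglerGrammar-derives a n ds bs bs≡m (|ds|≡ , offsets) =
  withLabel a S , (yields , unique , connected) , (+ 0 , + 0) , membership
  where
  open StagglerGrammar a bs (lg n) (barStart ds)
  open PCFG grammar using (Yields)
  S = bars (barStart ds) (mLen n) (lg n)

  yields : Yields (inj₂ zero) (+ 0 , + 0) (withLabel a S)
  yields = subst (λ m → Yields (inj₂ zero) (+ 0 , + 0) (withLabel a (bars (barStart ds) m (lg n)))) bs≡m start-yields

  unique : Unique (map proj₁ (withLabel a S))
  unique = subst Unique (sym (proj₁-withLabel a S)) (bars-unique {m = mLen n} (lg n))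

  connected : Connected (map proj₁ (withLabel a S))
  connected = subst Connected (sym (proj₁-withLabel a S)) (bars-connected {m = mLen n} {k = lg n} λ r r+1<lg →
    barStart-step r (subst (suc r ≤_) (sym |ds|≡) (<⇒≤∸1 r+1<lg)) offsets)

  membership : ∀ q b → (q , b) ∈ withLabel a S ⇔ (b ≡ a × InStaggler n ds (q ⊖ (+ 0 , + 0)))
  membership q b = subst (λ t → (q , b) ∈ withLabel a S ⇔ (b ≡ a × InStaggler n ds t)) (sym (⊖-identityʳ q))
    ((⇔-id _ ×-⇔ ∈-bars) ⇔-∘ ∈-withLabel)

k+3[1+k]≤7k : ∀ k → 1 ≤ k → k + 3 * suc k ≤ 7 * k
k+3[1+k]≤7k (suc k) _ = subst₂ _≤_ (sym (left k)) (sym (right k)) (ℕP.m≤m+n (7 + 4 * k) (3 * k))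
  where
  left : ∀ k → suc k + 3 * suc (suc k) ≡ 7 + 4 * k
  left = ℕRing.solve-∀
  right : ∀ k → 7 * suc k ≡ 7 + 4 * k + 3 * k
  right = ℕRing.solve-∀

lemma1 : Σ ℕ λ C → C > 0 ×
    (∀ (A : Set) (a : A) (n : ℕ) → n ≥ 4 → (ds : List ℤ) → ValidOffsets n ds →
      Σ (PCFG A) λ G → PCFG.size G ≤ C * lg n × DerivesStaggler G a n ds)
lemma1 = 7 , s≤s z≤n , grammarFor
  where
  grammarFor : ∀ (A : Set) (a : A) (n : ℕ) → n ≥ 4 → (ds : List ℤ) → ValidOffsets n ds →
    Σ (PCFG A) λ G → PCFG.size G ≤ 7 * lg n × DerivesStaggler G a n ds
  grammarFor A a n n≥4 ds valid with toBits (suc (lg n)) (mLen n) (ℕP.≤-<-trans (mLen≤n n) (n<2^[1+⌊log₂n⌋] n))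
  ... | bs , |bs|≡ , bs≡m =
    grammar , size≤ , stagglerGrammar-derives a n ds bs bs≡m valid
    where
    open StagglerGrammar a bs (lg n) (barStart ds)
    size≤ : PCFG.size grammar ≤ 7 * lg n
    size≤ = ℕP.≤-trans grammar-size
      (subst (λ l → lg n + 3 * l ≤ 7 * lg n) (sym |bs|≡) (k+3[1+k]≤7k (lg n) (ℕP.≤-trans (s≤s z≤n) (⌊log₂⌋-mono-≤ n≥4))))
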